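{- Let $m\in\mathbb{N}\setminus\{0,1\}$ and $c\in\mathbb{N}$. The map $f:\{S\in\mathcal{L}_m\mid \mathrm{C}(S)=c\}\to\{S\in\mathcal{L}_m\mid\mathrm{C}(S)=c+1\}$ defined by $f(S)=(\{\mathrm{m}(S)\}+S)\cup\{0\}$ is well defined and injective.
   Context: A numerical semigroup is a subset $S\subseteq\mathbb{N}$ containing $0$, closed under addition, with finite complement in $\mathbb{N}$; $\mathrm{m}(S)=\min(S\setminus\{0\})$; $\{a\}+S=\{a+s\mid s\in S\}$. $\mathcal{L}_m$ is the set of numerical semigroups with multiplicity $m$. An ideal of a numerical semigroup $\Delta$ is a nonempty $I\subseteq\Delta$ with $I+\Delta\subseteq I$; $\mathcal{J}(\Delta)$ is the set of numerical semigroups $U$ with $U\setminus\{0\}$ an ideal of $\Delta$; $\mathcal{J}(\mathscr{F})=\bigcup_{\Delta\in\mathscr{F}}\mathcal{J}(\Delta)$; $\mathcal{J}^0(\mathbb{N})=\{\mathbb{N}\}$, $\mathcal{J}^{k+1}(\mathbb{N})=\mathcal{J}(\mathcal{J}^k(\mathbb{N}))$; the complexity is $\mathrm{C}(S)=\min\{k\in\mathbb{N}\mid S\in\mathcal{J}^k(\mathbb{N})\}$. -}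

module Defs where

open import Data.Nat using (ℕ; zero; suc; _+_; _∸_; _≤_; _<_; _≡ᵇ_; _≤ᵇ_)
open import Data.Bool using (Bool; true; false; _∨_; _∧_)
open import Data.Product using (Σ; ∃; _×_; _,_)
open import Relation.Binary.PropositionalEquality using (_≡_; _≢_)

Subset : Set
Subset = ℕ → Bool

_∈_ : ℕ → Subset → Set
x ∈ S = S x ≡ true

infix 4 _∈_ _≐_

_≐_ : Subset → Subset → Set
S ≐ T = ∀ x → S x ≡ T x

ℕˢ : Subset
ℕˢ = λ _ → true

record IsNumericalSemigroup (S : Subset) : Set where
  field
    zero∈  : 0 ∈ S
    closed : ∀ x y → x ∈ S → y ∈ S → (x + y) ∈ S
    cofinite : ∃ λ F → ∀ n → F ≤ n → n ∈ S

IsMultiplicity : Subset → ℕ → Set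
IsMultiplicity S m = (m ∈ S) × (m ≢ 0) × (∀ x → 0 < x → x < m → S x ≡ false)

InL : ℕ → Subset → Set
InL m S = IsNumericalSemigroup S × IsMultiplicity S m

-- I = U \ {0} is an ideal of Δ: nonempty, I ⊆ Δ, I + Δ ⊆ I.
IsIdealMinusZero : Subset → Subset → Set
IsIdealMinusZero U Δ =
  (∃ λ x → x ≢ 0 × x ∈ U) ×
  (∀ x → x ≢ 0 → x ∈ U → x ∈ Δ) ×
  (∀ x y → x ≢ 0 → x ∈ U → y ∈ Δ → (x + y) ∈ U)

InJ : Subset → Subset → Set
InJ Δ U = IsNumericalSemigroup U × IsIdealMinusZero U Δ

InJk : ℕ → Subset → Set
InJk zero U = U ≐ ℕˢ
InJk (suc k) U = ∃ λ Δ → InJk k Δ × InJ Δ U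

HasComplexity : Subset → ℕ → Set
HasComplexity S c = InJk c S × (∀ k → InJk k S → c ≤ k)

-- ({a} + S) ∪ {0}
shift : ℕ → Subset → Subset
shift a S x = (x ≡ᵇ 0) ∨ ((a ≤ᵇ x) ∧ S (x ∸ a))

-- Every nonzero element of f(S) = {m} + S ∪ {0} lies in m + S ⊆ S, which makes f(S) an
-- ideal-semigroup of S, so C(f(S)) ≤ C(S) + 1. For the converse bound two facts suffice:
-- (a) a semigroup U ∈ 𝓙ᵏ(ℕ) contains every x ≥ k u for each nonzero u ∈ U, since
-- each of the k steps of the chain adds u to an element of the previous ideal; and (b) a
-- semigroup S of multiplicity m with [k m, ∞) ⊆ S lies in 𝓙ᵏ(ℕ), via the chain
-- ℕ = S ∪ [0, ∞) ⊇ S ∪ [m, ∞) ⊇ … ⊇ S ∪ [(k-1) m, ∞) ⊇ S. If f(S) ∈ 𝓙ᵏ⁺¹(ℕ), then (a)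
-- with u = m gives [(k+1) m, ∞) ⊆ f(S), i.e. [k m, ∞) ⊆ S, and (b) gives C(S) ≤ k.
-- Injectivity holds because f(S) determines S by S x = f(S) (m + x).
module Submission where

open import Defs
open import Data.Nat
  using (ℕ; zero; suc; _+_; _*_; _∸_; _≤_; _<_; _≤ᵇ_; z≤n; s≤s; NonZero; >-nonZero; ≢-nonZero⁻¹)
open import Data.Nat.Properties
open import Data.Bool using (true; false; _∨_)
open import Data.Bool.Properties using (∨-zeroʳ; T-≡; ¬-not)
open import Data.Product using (_×_; ∃-syntax; _,_)
open import Data.Sum using (_⊎_; inj₁; inj₂)
open import Function using (_∘_; id; Equivalence)
open import Relation.Nullary using (¬_; contradiction)
open import Relation.Binary.PropositionalEquality

infix 4 _⊆_ _⊇≥_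
infixl 6 _∪≥_

_⊆_ : Subset → Subset → Set
S ⊆ U = ∀ {x} → x ∈ S → x ∈ U

_⊇≥_ : Subset → ℕ → Set
U ⊇≥ F = ∀ x → F ≤ x → x ∈ U

m+n≤o⇒n≤o∸m : ∀ m {n o} → m + n ≤ o → n ≤ o ∸ m
m+n≤o⇒n≤o∸m m {n} {o} = m+n≤o⇒m≤o∸n n ∘ subst (_≤ o) (+-comm m n)

≤ᵇ-true : ∀ {a b} → a ≤ b → (a ≤ᵇ b) ≡ true
≤ᵇ-true = Equivalence.to T-≡ ∘ ≤⇒≤ᵇ

≤ᵇ-true⁻ : ∀ {a b} → (a ≤ᵇ b) ≡ true → a ≤ b
≤ᵇ-true⁻ {a} {b} = ≤ᵇ⇒≤ a b ∘ Equivalence.from T-≡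

multiplicity-≤ : ∀ {S m x} → IsMultiplicity S m → x ∈ S → x ≢ 0 → m ≤ x
multiplicity-≤ (_ , _ , below) x∈S x≢0 =
  ≮⇒≥ λ x<m → contradiction (trans (sym x∈S) (below _ (n≢0⇒n>0 x≢0) x<m)) λ ()

multiplicity≥2⇒¬InJk0 : ∀ {U m} → 2 ≤ m → IsMultiplicity U m → ¬ InJk 0 U
multiplicity≥2⇒¬InJk0 2≤m (_ , _ , below) U≐ℕ =
  contradiction (trans (sym (U≐ℕ 1)) (below 1 (s≤s z≤n) 2≤m)) λ ()

InJk⇒⊇≥* : ∀ k {U u} → InJk k U → u ≢ 0 → u ∈ U → U ⊇≥ k * u
InJk⇒⊇≥* zero    U≐ℕ _ _ x _ = U≐ℕ x
InJk⇒⊇≥* (suc k) {U} {u} (Δ , Δ∈Jᵏ , _ , _ , U⊆Δ , ideal) u≢0 u∈U x u+ku≤x =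
  subst (_∈ U) (m+[n∸m]≡n (m+n≤o⇒m≤o u u+ku≤x))
    (ideal u (x ∸ u) u≢0 u∈U
      (InJk⇒⊇≥* k Δ∈Jᵏ u≢0 (U⊆Δ u u≢0 u∈U) (x ∸ u) (m+n≤o⇒n≤o∸m u u+ku≤x)))

-- Opaque, so that S and b can be inferred from S ∪≥ b by unification.
opaque
  _∪≥_ : Subset → ℕ → Subset
  (S ∪≥ b) x = S x ∨ (b ≤ᵇ x)

  ∪≥-inj₁ : ∀ {S b} → S ⊆ S ∪≥ b
  ∪≥-inj₁ x∈S rewrite x∈S = refl

  ∪≥-inj₂ : ∀ {S b} → S ∪≥ b ⊇≥ b
  ∪≥-inj₂ {S} x b≤x rewrite ≤ᵇ-true b≤x = ∨-zeroʳ (S x)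

  ∪≥-case : ∀ {S b x} → x ∈ S ∪≥ b → x ∈ S ⊎ b ≤ x
  ∪≥-case {S} {x = x} x∈S∪ with S x
  ... | true  = inj₁ refl
  ... | false = inj₂ (≤ᵇ-true⁻ x∈S∪)

module _ {S : Subset} {b : ℕ} where

  ∪≥-isNumericalSemigroup : IsNumericalSemigroup S → IsNumericalSemigroup (S ∪≥ b)
  ∪≥-isNumericalSemigroup sg = record
    { zero∈    = ∪≥-inj₁ zero∈
    ; closed   = closed′
    ; cofinite = b , ∪≥-inj₂
    }
    where
    open IsNumericalSemigroup sg
    closed′ : ∀ x y → x ∈ S ∪≥ b → y ∈ S ∪≥ b → x + y ∈ S ∪≥ b
    closed′ x y x∈ y∈ with ∪≥-case x∈ | ∪≥-case y∈
    ... | inj₁ x∈S | inj₁ y∈S = ∪≥-inj₁ (closed x y x∈S y∈S)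
    ... | inj₂ b≤x | _        = ∪≥-inj₂ (x + y) (≤-trans b≤x (m≤m+n x y))
    ... | _        | inj₂ b≤y = ∪≥-inj₂ (x + y) (≤-trans b≤y (m≤n+m y x))

module _ {S : Subset} {m : ℕ} (mult : IsMultiplicity S m) where

  ∪≥-multiplicity-≤ : ∀ {b x} → x ∈ S ∪≥ (m + b) → x ≢ 0 → m ≤ x
  ∪≥-multiplicity-≤ {b} x∈ x≢0 with ∪≥-case x∈
  ... | inj₁ x∈S    = multiplicity-≤ mult x∈S x≢0
  ... | inj₂ m+b≤x = m+n≤o⇒m≤o m m+b≤x

  -- Since every nonzero element of U is ≥ m, adding one to an element ≥ b lands in [m + b, ∞).
  InJ-∪≥ : ∀ {U b} → IsNumericalSemigroup U → S ⊆ U → U ⊇≥ m + b → U ⊆ S ∪≥ (m + b) →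
           InJ (S ∪≥ b) U
  InJ-∪≥ {U} {b} sgU S⊆U U⊇ U⊆ = sgU , (m , m≢0 , S⊆U m∈S) , U⊆S∪b , ideal
    where
    m∈S : m ∈ S
    m∈S = let m∈S , _ = mult in m∈S
    m≢0 : m ≢ 0
    m≢0 = let _ , m≢0 , _ = mult in m≢0
    U⊆S∪b : ∀ x → x ≢ 0 → x ∈ U → x ∈ S ∪≥ b
    U⊆S∪b x _ x∈U with ∪≥-case (U⊆ x∈U)
    ... | inj₁ x∈S    = ∪≥-inj₁ x∈S
    ... | inj₂ m+b≤x = ∪≥-inj₂ x (m+n≤o⇒n≤o m m+b≤x)
    ideal : ∀ x y → x ≢ 0 → x ∈ U → y ∈ S ∪≥ b → x + y ∈ U
    ideal x y x≢0 x∈U y∈ with ∪≥-case y∈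
    ... | inj₁ y∈S = IsNumericalSemigroup.closed sgU x y x∈U (S⊆U y∈S)
    ... | inj₂ b≤y = U⊇ (x + y) (+-mono-≤ (∪≥-multiplicity-≤ (U⊆ x∈U) x≢0) b≤y)

  module _ (sg : IsNumericalSemigroup S) where

    InJk-∪≥* : ∀ j → InJk j (S ∪≥ j * m)
    InJk-∪≥* zero    x = ∪≥-inj₂ x z≤n
    InJk-∪≥* (suc j) = S ∪≥ j * m , InJk-∪≥* j ,
      InJ-∪≥ (∪≥-isNumericalSemigroup sg) ∪≥-inj₁ ∪≥-inj₂ id

    ⊇≥*⇒InJk : ∀ k → S ⊇≥ k * m → InJk k S
    ⊇≥*⇒InJk zero    S⊇ x = S⊇ x z≤n
    ⊇≥*⇒InJk (suc k) S⊇ = S ∪≥ k * m , InJk-∪≥* k , InJ-∪≥ sg id S⊇ ∪≥-inj₁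

shift-+ : ∀ m .{{_ : NonZero m}} (S : Subset) x → shift m S (m + x) ≡ S x
shift-+ (suc n) S x rewrite ≤ᵇ-true (m≤m+n (suc n) x) | m+n∸m≡n (suc n) x = refl

shift-injective : ∀ m .{{_ : NonZero m}} {S T} → shift m S ≐ shift m T → S ≐ T
shift-injective m {S} {T} eq x = begin
  S x                ≡⟨ shift-+ m S x ⟨
  shift m S (m + x)  ≡⟨ eq (m + x) ⟩
  shift m T (m + x)  ≡⟨ shift-+ m T x ⟩
  T x                ∎
  where open ≡-Reasoning

shift⁻ : ∀ m S x → x ≢ 0 → x ∈ shift m S → ∃[ s ] x ≡ m + s × s ∈ S
shift⁻ m S zero    x≢0 _ = contradiction refl x≢0
shift⁻ m S (suc x) _ x∈fS with m ≤ᵇ suc x in m≤ᵇx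
... | true  = suc x ∸ m , sym (m+[n∸m]≡n (≤ᵇ-true⁻ {m} m≤ᵇx)) , x∈fS
... | false with () ← x∈fS

module _ (m : ℕ) .{{_ : NonZero m}} {S : Subset} (sg : IsNumericalSemigroup S) (m∈S : m ∈ S) where
  open IsNumericalSemigroup sg

  +-∈-shift : ∀ {s} → s ∈ S → m + s ∈ shift m S
  +-∈-shift {s} s∈S = trans (shift-+ m S s) s∈S

  m∈shift : m ∈ shift m S
  m∈shift = subst (_∈ shift m S) (+-identityʳ m) (+-∈-shift zero∈)

  shift⊆ : shift m S ⊆ S
  shift⊆ {zero}  _ = zero∈
  shift⊆ {suc x} x∈fS with s , x≡m+s , s∈S ← shift⁻ m S (suc x) (λ ()) x∈fS =
    subst (_∈ S) (sym x≡m+s) (closed m s m∈S s∈S)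

  shift-ideal : ∀ x y → x ≢ 0 → x ∈ shift m S → y ∈ S → x + y ∈ shift m S
  shift-ideal x y x≢0 x∈fS y∈S with s , refl , s∈S ← shift⁻ m S x x≢0 x∈fS =
    subst (_∈ shift m S) (sym (+-assoc m s y)) (+-∈-shift (closed s y s∈S y∈S))

  shift-isNumericalSemigroup : IsNumericalSemigroup (shift m S)
  shift-isNumericalSemigroup = record
    { zero∈    = refl
    ; closed   = closed′
    ; cofinite = cofinite′ cofinite
    }
    where
    closed′ : ∀ x y → x ∈ shift m S → y ∈ shift m S → x + y ∈ shift m S
    closed′ zero    _ _ y∈fS = y∈fS
    closed′ (suc x) y x∈fS y∈fS = shift-ideal (suc x) y (λ ()) x∈fS (shift⊆ y∈fS)
    cofinite′ : ∃[ F ] S ⊇≥ F → ∃[ F ] shift m S ⊇≥ F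
    cofinite′ (F , S⊇) = m + F , λ x m+F≤x →
      subst (_∈ shift m S) (m+[n∸m]≡n (m+n≤o⇒m≤o m m+F≤x))
        (+-∈-shift (S⊇ (x ∸ m) (m+n≤o⇒n≤o∸m m m+F≤x)))

  shift-isMultiplicity : IsMultiplicity (shift m S) m
  shift-isMultiplicity = m∈shift , ≢-nonZero⁻¹ m , below
    where
    below : ∀ x → 0 < x → x < m → shift m S x ≡ false
    below x 0<x x<m = ¬-not λ x∈fS →
      let s , x≡m+s , _ = shift⁻ m S x (n>0⇒n≢0 0<x) x∈fS
      in m+n≮m m s (subst (_< m) x≡m+s x<m)

  shift-InJ : InJ S (shift m S)
  shift-InJ = shift-isNumericalSemigroup , (m , ≢-nonZero⁻¹ m , m∈shift) ,
              (λ _ _ → shift⊆) , shift-ideal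

  shift-InJk-suc⇒InJk : IsMultiplicity S m → ∀ k → InJk (suc k) (shift m S) → InJk k S
  shift-InJk-suc⇒InJk mult k fS∈Jᵏ⁺¹ = ⊇≥*⇒InJk mult sg k λ x km≤x →
    trans (sym (shift-+ m S x))
      (InJk⇒⊇≥* (suc k) fS∈Jᵏ⁺¹ (≢-nonZero⁻¹ m) m∈shift (m + x) (+-monoʳ-≤ m km≤x))

shift-complexity : ∀ {m c S} .{{_ : NonZero m}} → 2 ≤ m → InL m S → HasComplexity S c →
                   HasComplexity (shift m S) (suc c)
shift-complexity {m} {c} {S} 2≤m (sg , mult@(m∈S , _)) (S∈Jᶜ , c-least) =
  (S , S∈Jᶜ , shift-InJ m sg m∈S) , least
  where
  least : ∀ k → InJk k (shift m S) → suc c ≤ k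
  least zero    fS∈J⁰ =
    contradiction fS∈J⁰ (multiplicity≥2⇒¬InJk0 2≤m (shift-isMultiplicity m sg m∈S))
  least (suc k) fS∈Jᵏ⁺¹ = s≤s (c-least k (shift-InJk-suc⇒InJk m sg m∈S mult k fS∈Jᵏ⁺¹))

proposition38 : (m c : ℕ) → 2 ≤ m →
    ((S : Subset) → InL m S → HasComplexity S c →
    InL m (shift m S) × HasComplexity (shift m S) (suc c))
    × ((S T : Subset) → InL m S → HasComplexity S c →
    InL m T → HasComplexity T c →
    shift m S ≐ shift m T → S ≐ T)
proposition38 m c 2≤m = well-defined , λ _ _ _ _ _ _ → shift-injective m
  where
  instance
    m-nonZero : NonZero m
    m-nonZero = >-nonZero (≤-trans (s≤s z≤n) 2≤m)
  well-defined : (S : Subset) → InL m S → HasComplexity S c →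
                 InL m (shift m S) × HasComplexity (shift m S) (suc c)
  well-defined S S∈L@(sg , m∈S , _) C[S]≡c =
    (shift-isNumericalSemigroup m sg m∈S , shift-isMultiplicity m sg m∈S) ,
    shift-complexity 2≤m S∈L C[S]≡c
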